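{- Let $K_0$ be an infinite field. For all positive integers $n,m$ there is a finite set $G_{n,m}\subseteq GL_n(K_0)$ with the following property: for every field $K$ extending $K_0$ and all valuations $\operatorname{val}_1,\ldots,\operatorname{val}_m$ on $K$ that are trivial on $K_0$, every tuple $\vec{x}\in K^n$ is scrambled (with respect to $\operatorname{val}_1,\ldots,\operatorname{val}_m$) by some element of $G_{n,m}$.
   Context: Given valuations $\operatorname{val}_1,\ldots,\operatorname{val}_m$ on a field $K$, a tuple $\vec{y}=(y_1,\ldots,y_n)\in K^n$ is scrambled if $\operatorname{val}_i(y_1)=\operatorname{val}_i(y_2)=\cdots=\operatorname{val}_i(y_n)$ for every $i\le m$. A matrix $\mu\in GL_n(K)$ scrambles $\vec{x}$ if $\mu\cdot\vec{x}$ is scrambled. -}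

module Defs where

open import Level using (Level; _⊔_; Setω) renaming (suc to lsuc)
open import Data.Nat using (ℕ)
open import Data.Fin using (Fin)
open import Data.List using (List)
open import Data.List.Relation.Unary.All using (All)
open import Data.Product using (Σ; ∃; _×_; _,_)
open import Data.Sum using (_⊎_)
open import Relation.Nullary using (¬_)
open import Relation.Binary.Structures using (IsTotalOrder)
open import Algebra.Bundles using (CommutativeRing; AbelianGroup)
open import Algebra.Morphism.Structures using (module RingMorphisms)
import Algebra.Definitions.RawMonoid as RawMonoidDefs

record Field (c ℓ : Level) : Set (lsuc (c ⊔ ℓ)) where
  field
    commutativeRing : CommutativeRing c ℓ
  open CommutativeRing commutativeRing public
  field
    0≉1     : ¬ (0# ≈ 1#)
    inverse : ∀ x → ¬ (x ≈ 0#) → ∃ λ y → (x * y) ≈ 1#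

module F = Field

Infinite : ∀ {c ℓ} → Field c ℓ → Set (c ⊔ ℓ)
Infinite K = (xs : List (F.Carrier K)) → ∃ λ a → All (λ b → ¬ (F._≈_ K a b)) xs

-- A field extension K₀ ⊆ K, given by a (unital) ring homomorphism K₀ → K
-- (automatically injective since K₀ is a field).
record Extension {c₀ ℓ₀ c ℓ} (K₀ : Field c₀ ℓ₀) (K : Field c ℓ)
       : Set (c₀ ⊔ ℓ₀ ⊔ c ⊔ ℓ) where
  field
    ι     : F.Carrier K₀ → F.Carrier K
    isHom : RingMorphisms.IsRingHomomorphism (F.rawRing K₀) (F.rawRing K) ι

record OrderedAbelianGroup (g ℓ ℓ≤ : Level) : Set (lsuc (g ⊔ ℓ ⊔ ℓ≤)) where
  field
    abelianGroup : AbelianGroup g ℓ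
  open AbelianGroup abelianGroup public
  field
    _≤_          : Carrier → Carrier → Set ℓ≤
    isTotalOrder : IsTotalOrder _≈_ _≤_
    ∙-monoˡ-≤    : ∀ {x y} z → x ≤ y → (x ∙ z) ≤ (y ∙ z)

data WithTop {g} (G : Set g) : Set g where
  fin : G → WithTop G
  ∞   : WithTop G

module _ {g ℓ ℓ≤} (Γ : OrderedAbelianGroup g ℓ ℓ≤) where
  private module Γ = OrderedAbelianGroup Γ

  data _≈∞_ : WithTop Γ.Carrier → WithTop Γ.Carrier → Set (g ⊔ ℓ) where
    fin≈ : ∀ {a b} → a Γ.≈ b → fin a ≈∞ fin b
    ∞≈∞  : ∞ ≈∞ ∞

  data _≤∞_ : WithTop Γ.Carrier → WithTop Γ.Carrier → Set (g ⊔ ℓ≤) where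
    fin≤ : ∀ {a b} → a Γ.≤ b → fin a ≤∞ fin b
    _≤∞∞ : ∀ a → a ≤∞ ∞

  _+∞_ : WithTop Γ.Carrier → WithTop Γ.Carrier → WithTop Γ.Carrier
  fin a +∞ fin b = fin (a Γ.∙ b)
  fin a +∞ ∞     = ∞
  ∞     +∞ _     = ∞

record Valuation {c ℓ g ℓg ℓ≤} (K : Field c ℓ) (Γ : OrderedAbelianGroup g ℓg ℓ≤)
       : Set (c ⊔ ℓ ⊔ g ⊔ ℓg ⊔ ℓ≤) where
  field
    val      : F.Carrier K → WithTop (OrderedAbelianGroup.Carrier Γ)
    val-cong : ∀ {x y} → F._≈_ K x y → _≈∞_ Γ (val x) (val y)
    val-∞⇒0  : ∀ x → _≈∞_ Γ (val x) ∞ → F._≈_ K x (F.0# K)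
    val-0    : _≈∞_ Γ (val (F.0# K)) ∞
    val-*    : ∀ x y → _≈∞_ Γ (val (F._*_ K x y)) (_+∞_ Γ (val x) (val y))
    val-+    : ∀ x y → _≤∞_ Γ (val x) (val (F._+_ K x y))
                     ⊎ _≤∞_ Γ (val y) (val (F._+_ K x y))

open Valuation

TrivialOn : ∀ {c₀ ℓ₀ c ℓ g ℓg ℓ≤} {K₀ : Field c₀ ℓ₀} {K : Field c ℓ}
            {Γ : OrderedAbelianGroup g ℓg ℓ≤} →
            Extension K₀ K → Valuation K Γ → Set (c₀ ⊔ ℓ₀ ⊔ g ⊔ ℓg)
TrivialOn {K₀ = K₀} {Γ = Γ} E v =
  ∀ a → ¬ (F._≈_ K₀ a (F.0# K₀)) →
    _≈∞_ Γ (val v (Extension.ι E a)) (fin (OrderedAbelianGroup.ε Γ))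

Matrix : ∀ {a} → Set a → ℕ → Set a
Matrix A n = Fin n → Fin n → A

module _ {c ℓ} (K : Field c ℓ) where
  open RawMonoidDefs (Field.+-rawMonoid K) using (sum)

  _⊗_ : ∀ {n} → Matrix (F.Carrier K) n → Matrix (F.Carrier K) n → Matrix (F.Carrier K) n
  (A ⊗ B) i j = sum (λ k → F._*_ K (A i k) (B k j))

  identity : ∀ {n} → Matrix (F.Carrier K) n
  identity {n} i j with i Data.Fin.≟ j
  ... | Relation.Nullary.yes _ = F.1# K
  ... | Relation.Nullary.no _  = F.0# K

  _≈ᴹ_ : ∀ {n} → Matrix (F.Carrier K) n → Matrix (F.Carrier K) n → Set ℓ
  A ≈ᴹ B = ∀ i j → F._≈_ K (A i j) (B i j)

record GL {c ℓ} (n : ℕ) (K : Field c ℓ) : Set (c ⊔ ℓ) where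
  field
    mat     : Matrix (F.Carrier K) n
    inv     : Matrix (F.Carrier K) n
    inv-r   : _≈ᴹ_ K (_⊗_ K mat inv) (identity K)
    inv-l   : _≈ᴹ_ K (_⊗_ K inv mat) (identity K)

act : ∀ {c₀ ℓ₀ c ℓ n} {K₀ : Field c₀ ℓ₀} {K : Field c ℓ} →
      Extension K₀ K → GL n K₀ → (Fin n → F.Carrier K) → (Fin n → F.Carrier K)
act {K = K} E μ x j =
  RawMonoidDefs.sum (Field.+-rawMonoid K)
    (λ k → F._*_ K (Extension.ι E (GL.mat μ j k)) (x k))

Scrambled : ∀ {c ℓ g ℓg ℓ≤ m n} {K : Field c ℓ}
            {Γ : Fin m → OrderedAbelianGroup g ℓg ℓ≤} →
            ((i : Fin m) → Valuation K (Γ i)) → (Fin n → F.Carrier K) →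
            Set (g ⊔ ℓg)
Scrambled {Γ = Γ} v y = ∀ i j k → _≈∞_ (Γ i) (val (v i) (y j)) (val (v i) (y k))

record Σω {a} (A : Set a) (P : A → Setω) : Setω where
  constructor _,ω_
  field
    witness  : A
    property : P witness

{-# OPTIONS --safe #-}
-- For a valuation trivial on K₀, every combination Σ aₖ xₖ with aₖ ∈ K₀ has value at least
-- θ = minₖ val xₖ; say a attains the minimum when equality holds. The unit vector at a
-- minimising coordinate attains, and by the ultrametric inequality, if z attains and lies in
-- the span of p and q, then p or q attains. For distinct a ≠ b the vectors v + a·u and v + b·u
-- span both u and v, so if u or v attains, v + a·u attains for all but at most one a; among
-- any m + 1 distinct values of a one therefore works for all m valuations at once.
-- Adding one coordinate direction at a time gives a vector w that attains for every valuation,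
-- and then, for one of mn + 1 values of a, every row eⱼ + a·w of I + a·𝟙wᵀ attains for every
-- valuation, i.e. all coordinates of μx have the same values θᵢ. The values of a are fixed
-- in advance (K₀ is infinite), so the candidate matrices form a finite list independent of x;
-- keeping Σw ≠ 0 and avoiding one more value of a makes them invertible.
module Submission where

open import Defs
open import Level using (_⊔_)
open import Data.Nat using (ℕ; zero; suc; _≤_)
open import Data.Fin using (Fin; zero; suc; punchIn)
open import Data.Fin.Properties using (_≟_; punchInᵢ≢i; punchIn-injective; suc-injective)
open import Data.Vec.Functional using (Vector; replicate)
open import Data.Product using (Σ; ∃; ∃₂; _×_; _,_; proj₁; proj₂)
open import Data.Sum using (_⊎_; inj₁; inj₂)
import Data.Sum as Sum
open import Data.List using (List; []; _∷_; length; allFin; cartesianProduct; concatMap; tabulate)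
open import Data.List.Relation.Unary.Any using (Any; here; there)
import Data.List.Relation.Unary.Any as Any
open import Data.List.Relation.Unary.Any.Properties using (concatMap⁺; tabulate⁺)
open import Data.List.Membership.Propositional using (_∈_)
open import Data.List.Membership.Propositional.Properties using (∈-allFin; ∈-cartesianProduct⁺)
open import Data.List.Relation.Unary.All using (All; []; _∷_)
import Data.List.Relation.Unary.All as All
open import Data.Empty using (⊥-elim)
open import Function using (_∘_)
open import Relation.Nullary using (¬_; Dec; yes; no)
open import Relation.Binary.Bundles using (Setoid)
open import Relation.Binary.Structures using (IsTotalOrder)
open import Algebra.Morphism.Structures using (module RingMorphisms)
open import Relation.Binary.PropositionalEquality as ≡ using (_≡_; _≢_)
import Relation.Binary.Reasoning.Setoid as SetoidReasoning
import Algebra.Properties.Semiring.Sum as SemiringSum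
import Algebra.Properties.Ring as RingProperties
import Algebra.Properties.Group as GroupProperties
import Algebra.Solver.Ring.NaturalCoefficients.Default as NaturalCoefficients

module Pigeonhole {c ℓ} (S : Setoid c ℓ) where
  open Setoid S

  AtMostOneFailure : ∀ {p} → (Carrier → Set p) → Set (c ⊔ ℓ ⊔ p)
  AtMostOneFailure Q = ∀ x y → x ≉ y → Q x ⊎ Q y

  Distinct : ∀ {L} → (Fin L → Carrier) → Set ℓ
  Distinct f = ∀ s t → s ≢ t → f s ≉ f t

  AtMostOneFailure-→ : ∀ {p x} {X : Set x} {Q : Carrier → Set p} →
                       Dec X → (X → AtMostOneFailure Q) → AtMostOneFailure (λ a → X → Q a)
  AtMostOneFailure-→ (yes x) fails a b a≉b = Sum.map (λ Qa _ → Qa) (λ Qb _ → Qb) (fails x a b a≉b)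
  AtMostOneFailure-→ (no ¬x) _     a b _   = inj₁ (⊥-elim ∘ ¬x)

  common-witness : ∀ {i p} {I : Set i} (ps : List I) (Q : I → Carrier → Set p) →
                   (∀ q → AtMostOneFailure (Q q)) →
                   (f : Fin (suc (length ps)) → Carrier) → Distinct f →
                   ∃ λ t → All (λ q → Q q (f t)) ps
  common-witness []       Q fails f distinct = zero , []
  common-witness (q ∷ ps) Q fails f distinct
    with common-witness ps Q fails (f ∘ suc) (λ s t s≢t → distinct _ _ (s≢t ∘ suc-injective))
  ... | t₁ , all₁
    with common-witness ps Q fails (f ∘ punchIn (suc t₁))
           (λ s t s≢t → distinct _ _ (s≢t ∘ punchIn-injective (suc t₁) s t))
  ... | t₂ , all₂
    with fails q (f (suc t₁)) (f (punchIn (suc t₁) t₂))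
           (distinct _ _ (λ eq → punchInᵢ≢i (suc t₁) t₂ (≡.sym eq)))
  -- suc t₁ ≢ punchIn (suc t₁) t₂ both satisfy all of ps, and q fails at one of them at most.
  ... | inj₁ holds₁ = suc t₁ , holds₁ ∷ all₁
  ... | inj₂ holds₂ = punchIn (suc t₁) t₂ , holds₂ ∷ all₂

module FieldFacts {c ℓ} (K : Field c ℓ) where
  open Field K hiding (zero)
  open Pigeonhole setoid public
  open SetoidReasoning setoid
  open SemiringSum semiring
    using (sum; sum-remove; sum-cong-≋; sum-replicate-zero; ∑-distrib-+; *-distribˡ-sum; *-distribʳ-sum)
  open RingProperties ring using (-‿distribʳ-*; -‿distribˡ-*)
  open GroupProperties +-group using (//-rightDividesˡ; x∙y⁻¹≈ε⇒x≈y; inverseʳ-unique)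
  open NaturalCoefficients commutativeSemiring using (solve; _:+_; _:*_; _:=_; con)

  fresh-values : Infinite K → (L : ℕ) (avoid : List Carrier) →
                 ∃ λ (f : Fin L → Carrier) → Distinct f × (∀ s → All (f s ≉_) avoid)
  fresh-values infinite zero    avoid = (λ ()) , (λ ()) , (λ ())
  fresh-values infinite (suc L) avoid with infinite avoid
  ... | y , y∉avoid with fresh-values infinite L (y ∷ avoid)
  ... | f , distinct , fresh = g , g-distinct , g-fresh
    where
    g : Fin (suc L) → Carrier
    g zero    = y
    g (suc s) = f s
    g-distinct : Distinct g
    g-distinct zero    zero    s≢t = ⊥-elim (s≢t ≡.refl)
    g-distinct zero    (suc t) _   = All.head (fresh t) ∘ sym
    g-distinct (suc s) zero    _   = All.head (fresh s)
    g-distinct (suc s) (suc t) s≢t = distinct s t (s≢t ∘ ≡.cong suc)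
    g-fresh : ∀ s → All (g s ≉_) avoid
    g-fresh zero    = y∉avoid
    g-fresh (suc s) = All.tail (fresh s)

  fresh-values-avoiding : Infinite K → (L : ℕ) (c : Carrier) →
                          ∃ λ (f : Fin L → Carrier) → Distinct f × (∀ s → f s ≉ c)
  fresh-values-avoiding infinite L c with fresh-values infinite L (c ∷ [])
  ... | f , distinct , fresh = f , distinct , All.head ∘ fresh

  x≈y+[x-y] : ∀ x y → x ≈ y + (x - y)
  x≈y+[x-y] x y = sym (trans (+-comm y (x - y)) (//-rightDividesˡ y x))

  difference-invertible : ∀ {x y} → x ≉ y → ∃ λ d → d * (x - y) ≈ 1#
  difference-invertible {x} {y} x≉y with inverse (x - y) (x≉y ∘ x∙y⁻¹≈ε⇒x≈y x y)
  ... | d , [x-y]d≈1 = d , trans (*-comm d (x - y)) [x-y]d≈1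

  infixl 6 _+ᵛ_
  infixr 7 _·ᵛ_

  _+ᵛ_ : ∀ {n} → Vector Carrier n → Vector Carrier n → Vector Carrier n
  (u +ᵛ v) k = u k + v k

  _·ᵛ_ : ∀ {n} → Carrier → Vector Carrier n → Vector Carrier n
  (a ·ᵛ v) k = a * v k

  sum-+ᵛ·ᵛ : ∀ {n} (u v : Vector Carrier n) a → sum (u +ᵛ a ·ᵛ v) ≈ sum u + a * sum v
  sum-+ᵛ·ᵛ u v a = trans (∑-distrib-+ u (a ·ᵛ v)) (+-congˡ (sym (*-distribˡ-sum a v)))

  sum-single : ∀ {n} (t : Vector Carrier n) k → (∀ j → j ≢ k → t j ≈ 0#) → sum t ≈ t k
  sum-single {suc n} t k vanishes = begin
    sum t                                   ≈⟨ sum-remove t ⟩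
    t k + sum (λ j → t (punchIn k j))       ≈⟨ +-congˡ (sum-cong-≋ (λ j → vanishes _ (punchInᵢ≢i k j))) ⟩
    t k + sum (replicate n 0#)              ≈⟨ +-congˡ (sum-replicate-zero n) ⟩
    t k + 0#                                ≈⟨ +-identityʳ (t k) ⟩
    t k                                     ∎

  identity-diag : ∀ {n} (k : Fin n) → identity K k k ≈ 1#
  identity-diag k with k ≟ k
  ... | yes _  = refl
  ... | no k≢k = ⊥-elim (k≢k ≡.refl)

  identity-offdiag : ∀ {n} {j k : Fin n} → j ≢ k → identity K j k ≈ 0#
  identity-offdiag {j = j} {k} j≢k with j ≟ k
  ... | yes j≡k = ⊥-elim (j≢k j≡k)
  ... | no _    = refl

  sum-identity-* : ∀ {n} j (f : Vector Carrier n) → sum (λ k → identity K j k * f k) ≈ f j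
  sum-identity-* j f =
    trans (sum-single _ j (λ k k≢j → trans (*-congʳ (identity-offdiag (k≢j ∘ ≡.sym))) (zeroˡ (f k))))
          (trans (*-congʳ (identity-diag j)) (*-identityˡ (f j)))

  sum-*-identity : ∀ {n} j (f : Vector Carrier n) → sum (λ k → f k * identity K k j) ≈ f j
  sum-*-identity j f =
    trans (sum-single _ j (λ k k≢j → trans (*-congˡ (identity-offdiag k≢j)) (zeroʳ (f k))))
          (trans (*-congˡ (identity-diag j)) (*-identityʳ (f j)))

  sum-identity : ∀ {n} (k : Fin n) → sum (identity K k) ≈ 1#
  sum-identity k = trans (sum-single _ k (λ j j≢k → identity-offdiag (j≢k ∘ ≡.sym))) (identity-diag k)

  -- z = α p - β q, written without subtraction so that membership is a semiring identity.
  _∈Span⟨_,_⟩ : ∀ {n} → Vector Carrier n → Vector Carrier n → Vector Carrier n → Set (c ⊔ ℓ)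
  z ∈Span⟨ p , q ⟩ = ∃₂ λ α β → ∀ k → α * p k ≈ z k + β * q k

  direction∈Span : ∀ {n a b} (u v : Vector Carrier n) → a ≉ b → u ∈Span⟨ v +ᵛ a ·ᵛ u , v +ᵛ b ·ᵛ u ⟩
  direction∈Span {a = a} {b} u v a≉b with difference-invertible a≉b
  ... | d , d[a-b]≈1 = d , d , λ k → begin
    d * (v k + a * u k)                        ≈⟨ *-congˡ (+-congˡ (*-congʳ (x≈y+[x-y] a b))) ⟩
    d * (v k + (b + (a - b)) * u k)            ≈⟨ solve 5 (λ d v b D u → d :* (v :+ (b :+ D) :* u)
                                                    := (d :* D) :* u :+ d :* (v :+ b :* u))
                                                    refl d (v k) b (a - b) (u k) ⟩
    (d * (a - b)) * u k + d * (v k + b * u k)  ≈⟨ +-congʳ (trans (*-congʳ d[a-b]≈1) (*-identityˡ (u k))) ⟩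
    u k + d * (v k + b * u k)                  ∎

  base∈Span : ∀ {n a b} (u v : Vector Carrier n) → a ≉ b → v ∈Span⟨ v +ᵛ a ·ᵛ u , v +ᵛ b ·ᵛ u ⟩
  base∈Span {a = a} {b} u v a≉b with difference-invertible (a≉b ∘ sym)
  ... | d , d[b-a]≈1 = b * d , a * d , λ k → begin
    (b * d) * (v k + a * u k)
      ≈⟨ *-congʳ (*-congʳ (x≈y+[x-y] b a)) ⟩
    ((a + (b - a)) * d) * (v k + a * u k)
      ≈⟨ solve 5 (λ a D d v u → ((a :+ D) :* d) :* (v :+ a :* u)
                   := (d :* D) :* v :+ (a :* d) :* (v :+ (a :+ D) :* u))
                 refl a (b - a) d (v k) (u k) ⟩
    (d * (b - a)) * v k + (a * d) * (v k + (a + (b - a)) * u k)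
      ≈⟨ +-cong (trans (*-congʳ d[b-a]≈1) (*-identityˡ (v k)))
                (*-congˡ (+-congˡ (*-congʳ (sym (x≈y+[x-y] b a))))) ⟩
    v k + (a * d) * (v k + b * u k)
      ∎

  rankOne : ∀ {n} → Vector Carrier n → Carrier → Matrix Carrier n
  rankOne w a j = identity K j +ᵛ a ·ᵛ w

  sum-*-rankOne : ∀ {n} (u w : Vector Carrier n) b l →
                  sum (λ k → u k * rankOne w b k l) ≈ u l + sum u * (b * w l)
  sum-*-rankOne u w b l = begin
    sum (λ k → u k * (identity K k l + b * w l))
      ≈⟨ sum-cong-≋ (λ k → distribˡ (u k) _ _) ⟩
    sum (λ k → u k * identity K k l + u k * (b * w l))
      ≈⟨ ∑-distrib-+ (λ k → u k * identity K k l) (λ k → u k * (b * w l)) ⟩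
    sum (λ k → u k * identity K k l) + sum (λ k → u k * (b * w l))
      ≈⟨ +-cong (sum-*-identity l u) (sym (*-distribʳ-sum (b * w l) u)) ⟩
    u l + sum u * (b * w l)
      ∎

  rankOne-⊗ : ∀ {n} (w : Vector Carrier n) a b → a + b + a * b * sum w ≈ 0# →
              _≈ᴹ_ K (_⊗_ K (rankOne w a) (rankOne w b)) (identity K)
  rankOne-⊗ w a b vanishes j l = begin
    sum (λ k → rankOne w a j k * rankOne w b k l)
      ≈⟨ sum-*-rankOne (rankOne w a j) w b l ⟩
    (identity K j l + a * w l) + sum (rankOne w a j) * (b * w l)
      ≈⟨ +-congˡ (*-congʳ (trans (sum-+ᵛ·ᵛ (identity K j) w a) (+-congʳ (sum-identity j)))) ⟩
    (identity K j l + a * w l) + (1# + a * sum w) * (b * w l)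
      ≈⟨ solve 5 (λ δ a b σ x → (δ :+ a :* x) :+ (con 1 :+ a :* σ) :* (b :* x)
                   := δ :+ (a :+ b :+ a :* b :* σ) :* x)
                 refl (identity K j l) a b (sum w) (w l) ⟩
    identity K j l + (a + b + a * b * sum w) * w l
      ≈⟨ +-congˡ (trans (*-congʳ vanishes) (zeroˡ (w l))) ⟩
    identity K j l + 0#
      ≈⟨ +-identityʳ _ ⟩
    identity K j l
      ∎

  rankOne-inverse-scalar : ∀ {a σ t} → t * (1# + a * σ) ≈ 1# → a + - (a * t) + a * - (a * t) * σ ≈ 0#
  rankOne-inverse-scalar {a} {σ} {t} t[1+aσ]≈1 = begin
    a + b + a * b * σ          ≈⟨ solve 3 (λ a b σ → a :+ b :+ a :* b :* σ := a :+ b :* (con 1 :+ a :* σ)) refl a b σ ⟩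
    a + b * (1# + a * σ)       ≈⟨ +-congˡ (sym (-‿distribˡ-* (a * t) (1# + a * σ))) ⟩
    a + - (a * t * (1# + a * σ)) ≈⟨ +-congˡ (-‿cong (trans (*-assoc a t _) (trans (*-congˡ t[1+aσ]≈1) (*-identityʳ a)))) ⟩
    a + - a                    ≈⟨ -‿inverseʳ a ⟩
    0#                         ∎
    where b = - (a * t)

  rankOneGL : ∀ {n} (w : Vector Carrier n) a → 1# + a * sum w ≉ 0# → GL n K
  rankOneGL w a 1+aσ≉0 = record
    { mat   = rankOne w a
    ; inv   = rankOne w b
    ; inv-r = rankOne-⊗ w a b ab-relation
    ; inv-l = rankOne-⊗ w b a (trans (solve 3 (λ a b σ → b :+ a :+ b :* a :* σ := a :+ b :+ a :* b :* σ)
                                              refl a b (sum w)) ab-relation)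
    }
    where
    t = proj₁ (inverse (1# + a * sum w) 1+aσ≉0)
    b = - (a * t)
    ab-relation : a + b + a * b * sum w ≈ 0#
    ab-relation = rankOne-inverse-scalar (trans (*-comm t _) (proj₂ (inverse (1# + a * sum w) 1+aσ≉0)))

  1+aσ≉0 : ∀ {a σ s} → s * σ ≈ 1# → a ≉ - s → 1# + a * σ ≉ 0#
  1+aσ≉0 {a} {σ} {s} sσ≈1 a≉-s 1+aσ≈0 = a≉-s (begin
    a              ≈⟨ sym (*-identityʳ a) ⟩
    a * 1#         ≈⟨ *-congˡ (sym sσ≈1) ⟩
    a * (s * σ)    ≈⟨ solve 3 (λ a s σ → a :* (s :* σ) := s :* (a :* σ)) refl a s σ ⟩
    s * (a * σ)    ≈⟨ *-congˡ (inverseʳ-unique 1# (a * σ) 1+aσ≈0) ⟩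
    s * - 1#       ≈⟨ sym (-‿distribʳ-* s 1#) ⟩
    - (s * 1#)     ≈⟨ -‿cong (*-identityʳ s) ⟩
    - s            ∎)

  sum-shifted≉0 : ∀ {n a} (w : Vector Carrier n) k → a ≉ - sum w → sum (w +ᵛ a ·ᵛ identity K k) ≉ 0#
  sum-shifted≉0 {a = a} w k a≉-σ sum≈0 = a≉-σ (inverseʳ-unique (sum w) a (begin
    sum w + a                          ≈⟨ +-congˡ (sym (trans (*-congˡ (sum-identity k)) (*-identityʳ a))) ⟩
    sum w + a * sum (identity K k)     ≈⟨ sym (sum-+ᵛ·ᵛ w (identity K k) a) ⟩
    sum (w +ᵛ a ·ᵛ identity K k)       ≈⟨ sum≈0 ⟩
    0#                                 ∎))

module WithTopOrder {g ℓ ℓ≤} (Γ : OrderedAbelianGroup g ℓ ℓ≤) where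
  private
    module Γ = OrderedAbelianGroup Γ
    module Γ≤ = IsTotalOrder Γ.isTotalOrder

  ≈∞-refl : ∀ {a} → _≈∞_ Γ a a
  ≈∞-refl {fin a} = fin≈ Γ.refl
  ≈∞-refl {∞}     = ∞≈∞

  ≈∞-sym : ∀ {a b} → _≈∞_ Γ a b → _≈∞_ Γ b a
  ≈∞-sym (fin≈ a≈b) = fin≈ (Γ.sym a≈b)
  ≈∞-sym ∞≈∞        = ∞≈∞

  ≈∞-trans : ∀ {a b c} → _≈∞_ Γ a b → _≈∞_ Γ b c → _≈∞_ Γ a c
  ≈∞-trans (fin≈ a≈b) (fin≈ b≈c) = fin≈ (Γ.trans a≈b b≈c)
  ≈∞-trans ∞≈∞        ∞≈∞        = ∞≈∞

  ≤∞-reflexive : ∀ {a b} → _≈∞_ Γ a b → _≤∞_ Γ a b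
  ≤∞-reflexive (fin≈ a≈b) = fin≤ (Γ≤.reflexive a≈b)
  ≤∞-reflexive ∞≈∞        = ∞ ≤∞∞

  ≤∞-refl : ∀ {a} → _≤∞_ Γ a a
  ≤∞-refl = ≤∞-reflexive ≈∞-refl

  ≤∞-trans : ∀ {a b c} → _≤∞_ Γ a b → _≤∞_ Γ b c → _≤∞_ Γ a c
  ≤∞-trans (fin≤ a≤b) (fin≤ b≤c) = fin≤ (Γ≤.trans a≤b b≤c)
  ≤∞-trans (fin≤ _)   (_ ≤∞∞)    = _ ≤∞∞
  ≤∞-trans (_ ≤∞∞)    (_ ≤∞∞)    = _ ≤∞∞

  ≤∞-antisym : ∀ {a b} → _≤∞_ Γ a b → _≤∞_ Γ b a → _≈∞_ Γ a b
  ≤∞-antisym (fin≤ a≤b) (fin≤ b≤a) = fin≈ (Γ≤.antisym a≤b b≤a)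
  ≤∞-antisym (.∞ ≤∞∞)   (.∞ ≤∞∞)   = ∞≈∞

  ≤∞-total : ∀ a b → _≤∞_ Γ a b ⊎ _≤∞_ Γ b a
  ≤∞-total (fin a) (fin b) with Γ≤.total a b
  ... | inj₁ a≤b = inj₁ (fin≤ a≤b)
  ... | inj₂ b≤a = inj₂ (fin≤ b≤a)
  ≤∞-total a       ∞       = inj₁ (a ≤∞∞)
  ≤∞-total ∞       (fin b) = inj₂ (fin b ≤∞∞)

  ≤∞-+ˡ : ∀ {a} b → _≤∞_ Γ (fin Γ.ε) a → _≤∞_ Γ b (_+∞_ Γ a b)
  ≤∞-+ˡ {∞}     b       _          = b ≤∞∞
  ≤∞-+ˡ {fin a} ∞       _          = ∞ ≤∞∞
  ≤∞-+ˡ {fin a} (fin b) (fin≤ 0≤a) =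
    fin≤ (Γ≤.trans (Γ≤.reflexive (Γ.sym (Γ.identityˡ b))) (Γ.∙-monoˡ-≤ b 0≤a))

  argmin : ∀ {n} (f : Fin (suc n) → WithTop Γ.Carrier) → ∃ λ k → ∀ j → _≤∞_ Γ (f k) (f j)
  argmin {zero}  f = zero , λ { zero → ≤∞-refl }
  argmin {suc n} f with argmin (f ∘ suc)
  ... | k , f-k≤ with ≤∞-total (f zero) (f (suc k))
  ... | inj₁ f0≤fk = zero  , λ { zero → ≤∞-refl ; (suc j) → ≤∞-trans f0≤fk (f-k≤ j) }
  ... | inj₂ fk≤f0 = suc k , λ { zero → fk≤f0   ; (suc j) → f-k≤ j }

module ValuationFacts {c₀ ℓ₀ c ℓ g ℓg ℓ≤} {K₀ : Field c₀ ℓ₀} {K : Field c ℓ} (E : Extension K₀ K)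
                      {Γ : OrderedAbelianGroup g ℓg ℓ≤} (v : Valuation K Γ) (trivial : TrivialOn E v) where
  private
    module K₀ = Field K₀
    module Γ = OrderedAbelianGroup Γ
    module Hom = RingMorphisms (F.rawRing K₀) (F.rawRing K)
    module ι = Hom.IsRingHomomorphism (Extension.isHom E)
  open Field K hiding (zero)
  open Valuation v
  open WithTopOrder Γ
  private
    module KF = FieldFacts K
    module K₀F = FieldFacts K₀
    module K₀-group = GroupProperties K₀.+-group
    module K₀-ring = RingProperties K₀.ring
  open K₀F using (_∈Span⟨_,_⟩; direction∈Span; base∈Span; AtMostOneFailure; _+ᵛ_; _·ᵛ_)
  open NaturalCoefficients commutativeSemiring using (solve; _:+_; _:*_; _:=_)
  open SemiringSum semiring using (sum; sum-cong-≋; ∑-distrib-+; *-distribˡ-sum)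
  open SetoidReasoning setoid

  ι : K₀.Carrier → Carrier
  ι = Extension.ι E

  val-ι-zero : ∀ {a} → a K₀.≈ K₀.0# → _≈∞_ Γ (val (ι a)) ∞
  val-ι-zero a≈0 = ≈∞-trans (val-cong (trans (ι.⟦⟧-cong a≈0) ι.0#-homo)) val-0

  -- We cannot decide a ≈ 0, but the case split on the value val (ι a) suffices.
  val-ι-nonneg : ∀ a → _≤∞_ Γ (fin Γ.ε) (val (ι a))
  val-ι-nonneg a = nonneg (val (ι a)) (λ val≉∞ → trivial a (val≉∞ ∘ val-ι-zero))
    where
    nonneg : ∀ w → (¬ _≈∞_ Γ w ∞ → _≈∞_ Γ w (fin Γ.ε)) → _≤∞_ Γ (fin Γ.ε) w
    nonneg ∞       _       = _ ≤∞∞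
    nonneg (fin b) finite⇒0 = ≤∞-reflexive (≈∞-sym (finite⇒0 λ ()))

  val-≤-ι* : ∀ a y → _≤∞_ Γ (val y) (val (ι a * y))
  val-≤-ι* a y = ≤∞-trans (≤∞-+ˡ (val y) (val-ι-nonneg a)) (≤∞-reflexive (≈∞-sym (val-* (ι a) y)))

  val-sum-≥ : ∀ {n θ} (f : Fin n → Carrier) → (∀ k → _≤∞_ Γ θ (val (f k))) → _≤∞_ Γ θ (val (sum f))
  val-sum-≥ {zero}  f _     = ≤∞-trans (_ ≤∞∞) (≤∞-reflexive (≈∞-sym val-0))
  val-sum-≥ {suc n} f θ≤f with val-+ (f zero) (sum (f ∘ suc))
  ... | inj₁ f0≤ = ≤∞-trans (θ≤f zero) f0≤
  ... | inj₂ f+≤ = ≤∞-trans (val-sum-≥ (f ∘ suc) (θ≤f ∘ suc)) f+≤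

  val-≤-split : ∀ {θ} α β p q z → z ≈ ι α * p + ι β * q → _≤∞_ Γ (val z) θ →
                _≤∞_ Γ (val p) θ ⊎ _≤∞_ Γ (val q) θ
  val-≤-split α β p q z z≈ val-z≤θ =
    Sum.map (λ αp≤ → ≤∞-trans (val-≤-ι* α p) (≤∞-trans αp≤ sum≤θ))
            (λ βq≤ → ≤∞-trans (val-≤-ι* β q) (≤∞-trans βq≤ sum≤θ))
            (val-+ (ι α * p) (ι β * q))
    where
    sum≤θ : _≤∞_ Γ (val (ι α * p + ι β * q)) _
    sum≤θ = ≤∞-trans (≤∞-reflexive (val-cong (sym z≈))) val-z≤θ

  ι-identity : ∀ {n} (j k : Fin n) → ι (identity K₀ j k) ≈ identity K j k
  ι-identity j k = by-cases (j ≟ k)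
    where
    by-cases : Dec (j ≡ k) → ι (identity K₀ j k) ≈ identity K j k
    by-cases (yes ≡.refl) =
      trans (ι.⟦⟧-cong (K₀F.identity-diag j)) (trans ι.1#-homo (sym (KF.identity-diag j)))
    by-cases (no j≢k)     =
      trans (ι.⟦⟧-cong (K₀F.identity-offdiag j≢k)) (trans ι.0#-homo (sym (KF.identity-offdiag j≢k)))

  module Combination {n} (x : Fin (suc n) → Carrier) where
    combine : (Fin (suc n) → K₀.Carrier) → Carrier
    combine a = sum (λ k → ι (a k) * x k)

    combine-identity : ∀ k → combine (identity K₀ k) ≈ x k
    combine-identity k =
      trans (sum-cong-≋ {y = λ j → identity K k j * x j} (λ j → *-congʳ (ι-identity k j)))
            (KF.sum-identity-* k x)

    combine-linear : ∀ {α γ p q z} → (∀ k → z k K₀.≈ α K₀.* p k K₀.+ γ K₀.* q k) →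
                     combine z ≈ ι α * combine p + ι γ * combine q
    combine-linear {α} {γ} {p} {q} {z} z≈ = begin
      sum (λ k → ι (z k) * x k)
        ≈⟨ sum-cong-≋ {y = λ k → ι α * (ι (p k) * x k) + ι γ * (ι (q k) * x k)}
                      (λ k → trans (*-congʳ (ι-linear k)) (distribute (ι α) (ι γ) (ι (p k)) (ι (q k)) (x k))) ⟩
      sum (λ k → ι α * (ι (p k) * x k) + ι γ * (ι (q k) * x k))
        ≈⟨ ∑-distrib-+ (λ k → ι α * (ι (p k) * x k)) (λ k → ι γ * (ι (q k) * x k)) ⟩
      sum (λ k → ι α * (ι (p k) * x k)) + sum (λ k → ι γ * (ι (q k) * x k))
        ≈⟨ sym (+-cong (*-distribˡ-sum (ι α) (λ k → ι (p k) * x k))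
                       (*-distribˡ-sum (ι γ) (λ k → ι (q k) * x k))) ⟩
      ι α * combine p + ι γ * combine q
        ∎
      where
      ι-linear : ∀ k → ι (z k) ≈ ι α * ι (p k) + ι γ * ι (q k)
      ι-linear k = trans (ι.⟦⟧-cong (z≈ k)) (trans (ι.+-homo _ _) (+-cong (ι.*-homo α (p k)) (ι.*-homo γ (q k))))
      distribute : ∀ a c y y′ t → (a * y + c * y′) * t ≈ a * (y * t) + c * (y′ * t)
      distribute = solve 5 (λ a c y y′ t → (a :* y :+ c :* y′) :* t := a :* (y :* t) :+ c :* (y′ :* t)) refl

    minimum : ∃ λ k → ∀ j → _≤∞_ Γ (val (x k)) (val (x j))
    minimum = argmin (val ∘ x)

    θ : WithTop Γ.Carrier
    θ = val (x (proj₁ minimum))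

    AttainsMin : (Fin (suc n) → K₀.Carrier) → Set (g ⊔ ℓ≤)
    AttainsMin a = _≤∞_ Γ (val (combine a)) θ

    θ≤val-combine : ∀ a → _≤∞_ Γ θ (val (combine a))
    θ≤val-combine a = val-sum-≥ _ (λ k → ≤∞-trans (proj₂ minimum k) (val-≤-ι* (a k) (x k)))

    attainsMin⇒≈θ : ∀ a → AttainsMin a → _≈∞_ Γ (val (combine a)) θ
    attainsMin⇒≈θ a attains = ≤∞-antisym attains (θ≤val-combine a)

    attainsMin-identity : AttainsMin (identity K₀ (proj₁ minimum))
    attainsMin-identity = ≤∞-reflexive (val-cong (combine-identity (proj₁ minimum)))

    attainsMin-∈Span : ∀ {z p q} → z ∈Span⟨ p , q ⟩ → AttainsMin z → AttainsMin p ⊎ AttainsMin q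
    attainsMin-∈Span {z} {p} {q} (α , β , αp≈z+βq) =
      val-≤-split α (K₀.- β) (combine p) (combine q) (combine z) (combine-linear z≈)
      where
      z≈ : ∀ k → z k K₀.≈ α K₀.* p k K₀.+ (K₀.- β) K₀.* q k
      z≈ k = K₀.trans (K₀-group.x≈z//y (z k) (β K₀.* q k) (α K₀.* p k) (K₀.sym (αp≈z+βq k)))
                      (K₀.+-congˡ (K₀-ring.-‿distribˡ-* β (q k)))

    attainsMin-line : ∀ u w → AttainsMin u ⊎ AttainsMin w →
                      AtMostOneFailure (λ a → AttainsMin (w +ᵛ a ·ᵛ u))
    attainsMin-line u w (inj₁ u-attains) a b a≉b = attainsMin-∈Span (direction∈Span u w a≉b) u-attains
    attainsMin-line u w (inj₂ w-attains) a b a≉b = attainsMin-∈Span (base∈Span u w a≉b) w-attains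


module Construction {c₀ ℓ₀} (K₀ : Field c₀ ℓ₀) (infinite : Infinite K₀) (n m : ℕ) where
  open Field K₀ hiding (zero)
  open FieldFacts K₀
  open SemiringSum semiring using (sum)
  open import Data.List.Membership.DecPropositional (_≟_ {suc n}) using (_∈?_)

  valuations : List (Fin m)
  valuations = allFin m

  entries : List (Fin m × Fin (suc n))
  entries = cartesianProduct (allFin m) (allFin (suc n))

  -- A nonzero sum makes rankOne w a invertible for all but one value of a.
  Candidate : Set (c₀ ⊔ ℓ₀)
  Candidate = Σ (Vector Carrier (suc n)) λ w → sum w ≉ 0#

  stepValues : (σ : Carrier) →
               ∃ λ (f : Fin (suc (length valuations)) → Carrier) → Distinct f × (∀ s → f s ≉ - σ)
  stepValues σ = fresh-values-avoiding infinite _ (- σ)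

  extend : Candidate → Fin (suc n) → Fin (suc (length valuations)) → Candidate
  extend (w , _) k s = w +ᵛ proj₁ (stepValues (sum w)) s ·ᵛ identity K₀ k
                       , sum-shifted≉0 w k (proj₂ (proj₂ (stepValues (sum w))) s)

  candidates : List (Fin (suc n)) → List Candidate
  candidates []       = (identity K₀ zero , λ Σe₀≈0 → 0≉1 (trans (sym Σe₀≈0) (sum-identity {suc n} zero))) ∷ []
  candidates (k ∷ ks) = concatMap (λ c → tabulate (extend c k)) (candidates ks)

  sum-inverse : (c : Candidate) → ∃ λ s → s * sum (proj₁ c) ≈ 1#
  sum-inverse (w , σ≉0) = proj₁ σ⁻¹ , trans (*-comm _ (sum w)) (proj₂ σ⁻¹)
    where σ⁻¹ = inverse (sum w) σ≉0

  finalValues : (c : Candidate) →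
                ∃ λ (f : Fin (suc (length entries)) → Carrier) → Distinct f × (∀ s → f s ≉ - proj₁ (sum-inverse c))
  finalValues c = fresh-values-avoiding infinite _ (- proj₁ (sum-inverse c))

  matrixFor : Candidate → Fin (suc (length entries)) → GL (suc n) K₀
  matrixFor c s = rankOneGL (proj₁ c) (proj₁ (finalValues c) s)
                            (1+aσ≉0 (proj₂ (sum-inverse c)) (proj₂ (proj₂ (finalValues c)) s))

  G : List (GL (suc n) K₀)
  G = concatMap (λ c → tabulate (matrixFor c)) (candidates (allFin (suc n)))

  module Scrambling {c ℓ g ℓg ℓ≤} (K : Field c ℓ) (E : Extension K₀ K)
                    (Γ : Fin m → OrderedAbelianGroup g ℓg ℓ≤) (v : (i : Fin m) → Valuation K (Γ i))
                    (trivial : ∀ i → TrivialOn E (v i)) (x : Fin (suc n) → Field.Carrier K) where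
    module Min (i : Fin m) = ValuationFacts.Combination E (v i) (trivial i) x
    open Min using (AttainsMin)

    argminPos : Fin m → Fin (suc n)
    argminPos i = proj₁ (Min.minimum i)

    AttainsMinAt : List (Fin (suc n)) → Vector Carrier (suc n) → Set (g ⊔ ℓ≤)
    AttainsMinAt ks w = ∀ i → argminPos i ∈ ks → AttainsMin i w

    candidates-attain : ∀ ks → Any (AttainsMinAt ks ∘ proj₁) (candidates ks)
    candidates-attain []       = here (λ i ())
    candidates-attain (k ∷ ks) =
      concatMap⁺ (λ c → tabulate (extend c k)) (Any.map (λ {c} → extension-attains {c}) (candidates-attain ks))
      where
      extension-attains : ∀ {c} → AttainsMinAt ks (proj₁ c) →
                          Any (AttainsMinAt (k ∷ ks) ∘ proj₁) (tabulate (extend c k))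
      extension-attains {c} attains =
        tabulate⁺ {f = extend c k} (proj₁ witness) (λ i → All.lookup (proj₂ witness) (∈-allFin i))
        where
        w = proj₁ c
        Q : Fin m → Carrier → Set (g ⊔ ℓ≤)
        Q i a = argminPos i ∈ k ∷ ks → AttainsMin i (w +ᵛ a ·ᵛ identity K₀ k)
        relevant : ∀ i → argminPos i ∈ k ∷ ks → AttainsMin i (identity K₀ k) ⊎ AttainsMin i w
        relevant i (here i≡k)   = inj₁ (≡.subst (AttainsMin i ∘ identity K₀) i≡k (Min.attainsMin-identity i))
        relevant i (there i∈ks) = inj₂ (attains i i∈ks)
        fails : ∀ i → AtMostOneFailure (Q i)
        fails i = AtMostOneFailure-→ (argminPos i ∈? k ∷ ks)
                                     (Min.attainsMin-line i (identity K₀ k) w ∘ relevant i)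
        witness = common-witness valuations Q fails
                    (proj₁ (stepValues (sum w))) (proj₁ (proj₂ (stepValues (sum w))))

    rows-attain⇒scrambled : ∀ μ → (∀ i j → AttainsMin i (GL.mat μ j)) → Scrambled v (act E μ x)
    rows-attain⇒scrambled μ attains i j k =
      ≈∞-trans (Min.attainsMin⇒≈θ i (GL.mat μ j) (attains i j))
               (≈∞-sym (Min.attainsMin⇒≈θ i (GL.mat μ k) (attains i k)))
      where open WithTopOrder (Γ i)

    scrambled : Any (λ μ → Scrambled v (act E μ x)) G
    scrambled = concatMap⁺ (λ c → tabulate (matrixFor c))
                           (Any.map (λ {c} → matrix-scrambles {c}) (candidates-attain (allFin (suc n))))
      where
      matrix-scrambles : ∀ {c} → AttainsMinAt (allFin (suc n)) (proj₁ c) →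
                         Any (λ μ → Scrambled v (act E μ x)) (tabulate (matrixFor c))
      matrix-scrambles {c} attains =
        tabulate⁺ {f = matrixFor c} s (rows-attain⇒scrambled (matrixFor c s) rows-attain)
        where
        Q : Fin m × Fin (suc n) → Carrier → Set (g ⊔ ℓ≤)
        Q (i , j) a = AttainsMin i (identity K₀ j +ᵛ a ·ᵛ proj₁ c)
        fails : ∀ e → AtMostOneFailure (Q e)
        fails (i , j) =
          Min.attainsMin-line i (proj₁ c) (identity K₀ j) (inj₁ (attains i (∈-allFin (argminPos i))))
        witness = common-witness entries Q fails (proj₁ (finalValues c)) (proj₁ (proj₂ (finalValues c)))
        s = proj₁ witness
        rows-attain : ∀ i j → AttainsMin i (GL.mat (matrixFor c s) j)
        rows-attain i j = All.lookup (proj₂ witness) (∈-cartesianProduct⁺ (∈-allFin i) (∈-allFin j))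

lemma3p3 : ∀ {c₀ ℓ₀} (K₀ : Field c₀ ℓ₀) → Infinite K₀ →
    (n m : ℕ) → 1 ≤ n → 1 ≤ m →
    Σω (List (GL n K₀)) λ G →
      ∀ {c ℓ g ℓg ℓ≤} (K : Field c ℓ) (E : Extension K₀ K)
        (Γ : Fin m → OrderedAbelianGroup g ℓg ℓ≤)
        (v : (i : Fin m) → Valuation K (Γ i)) →
        (∀ i → TrivialOn E (v i)) →
        (x : Fin n → Field.Carrier K) →
        Any (λ μ → Scrambled v (act E μ x)) G
lemma3p3 K₀ infinite zero    m () _
lemma3p3 K₀ infinite (suc n) m _  _ =
  G ,ω λ K E Γ v trivial x → Scrambling.scrambled K E Γ v trivial x
  where open Construction K₀ infinite n m
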